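{- Let $\mathbf S=(S,\leq,*,1)$ be a skew Hilbert algebra and $\Theta$ a congruence on $\mathbf S$. Then every class of $\Theta$ is a convex subset of $(S,\leq)$.
   Context: For a poset and a subset $A$, $L(A)$, $U(A)$ are the sets of lower and upper bounds; $L(U(x,y),z)=L(U(\{x,y\})\cup\{z\})$. A skew Hilbert algebra is a poset $(S,\leq,*,1)$ with binary operation $*$ and constant $1$ such that for all $x,y,z$: (S1) $x\leq y$ iff $x*y=1$; (S2) if $y*x=1$ then $x*((x*y)*y)=1$; (S3) if $x*y=1$ then $(y*z)*(x*z)=1$; (S4) $L(U(x,y),x*y)=L(y)$. An algebraic congruence on $\mathbf S$ is a congruence of the groupoid $(S,*)$. A binary relation $\rho$ on $S$ is min-stable if whenever $(a,b),(c,d)\in\rho$ with $a,c$ comparable and $b,d$ comparable, then $(\min(a,c),\min(b,d))\in\rho$. A congruence on $\mathbf S$ is a min-stable algebraic congruence. -}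

module Defs where

open import Level using (Level; _⊔_; suc)
open import Data.Product using (_×_; _,_)
open import Data.Sum using (_⊎_)
open import Relation.Binary.PropositionalEquality using (_≡_)
open import Relation.Binary.Structures using (IsPartialOrder; IsEquivalence)
open import Function.Bundles using (_⇔_)

record SkewHilbertAlgebra (a ℓ : Level) : Set (suc (a ⊔ ℓ)) where
  infix 4 _≤_
  infixr 5 _*_
  field
    S : Set a
    _≤_ : S → S → Set ℓ
    _*_ : S → S → S
    𝟏 : S
    isPartialOrder : IsPartialOrder _≡_ _≤_

  UB : S → S → S → Set ℓ
  UB x y u = x ≤ u × y ≤ u

  -- w ∈ L(U(x,y), z) = L(U({x,y}) ∪ {z})
  LUz : S → S → S → S → Set (a ⊔ ℓ)
  LUz x y z w = (∀ u → UB x y u → w ≤ u) × w ≤ z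

  field
    S1 : ∀ x y → (x ≤ y) ⇔ (x * y ≡ 𝟏)
    S2 : ∀ x y → y * x ≡ 𝟏 → x * ((x * y) * y) ≡ 𝟏
    S3 : ∀ x y z → x * y ≡ 𝟏 → (y * z) * (x * z) ≡ 𝟏
    -- L(U(x,y), x*y) = L(y), as equality of subsets of S
    S4 : ∀ x y w → LUz x y (x * y) w ⇔ (w ≤ y)

module _ {a ℓ : Level} (𝐒 : SkewHilbertAlgebra a ℓ) where
  open SkewHilbertAlgebra 𝐒

  -- m = min(x , y), which exists exactly when x and y are comparable
  IsMin : S → S → S → Set (a ⊔ ℓ)
  IsMin x y m = (x ≤ y × m ≡ x) ⊎ (y ≤ x × m ≡ y)

  record IsAlgebraicCongruence {r : Level} (Θ : S → S → Set r) : Set (a ⊔ r) where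
    field
      isEquivalence : IsEquivalence Θ
      compatible : ∀ {x x′ y y′} → Θ x x′ → Θ y y′ → Θ (x * y) (x′ * y′)

  MinStable : {r : Level} → (S → S → Set r) → Set (a ⊔ ℓ ⊔ r)
  MinStable Θ = ∀ {p q c d} → Θ p q → Θ c d →
    ∀ m n → IsMin p c m → IsMin q d n → Θ m n

  record IsCongruence {r : Level} (Θ : S → S → Set r) : Set (a ⊔ ℓ ⊔ r) where
    field
      isAlgebraicCongruence : IsAlgebraicCongruence Θ
      minStable : MinStable Θ

  Convex : {r : Level} → (S → Set r) → Set (a ⊔ ℓ ⊔ r)
  Convex A = ∀ {x y z} → A x → A z → x ≤ y → y ≤ z → A y

-- Only min-stability of an equivalence is needed: if p Θ c and p ≤ b ≤ c, apply
-- min-stability to the pairs (p , c) and (b , b); since min(p , b) = p and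
-- min(c , b) = b, this gives p Θ b.
module Submission where

open import Defs
open import Level using (Level)
open import Data.Product using (_,_)
open import Data.Sum using (inj₁; inj₂)
open import Relation.Binary.PropositionalEquality using (_≡_)
open import Relation.Binary.Structures using (IsEquivalence)

module _ {a ℓ r : Level} (𝐒 : SkewHilbertAlgebra a ℓ)
         {Θ : SkewHilbertAlgebra.S 𝐒 → SkewHilbertAlgebra.S 𝐒 → Set r}
         (isEquivalence : IsEquivalence Θ) (minStable : MinStable 𝐒 Θ) where
  open SkewHilbertAlgebra 𝐒
  open IsEquivalence isEquivalence using (refl; sym; trans)

  minStable⇒related-between : ∀ {p b c} → Θ p c → p ≤ b → b ≤ c → Θ p b
  minStable⇒related-between {p} {b} p∼c p≤b b≤c =
    minStable p∼c (refl {b}) p b (inj₁ (p≤b , _≡_.refl)) (inj₂ (b≤c , _≡_.refl))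

  minStable⇒convex-classes : ∀ x → Convex 𝐒 (Θ x)
  minStable⇒convex-classes x x∼p x∼c p≤b b≤c =
    trans x∼p (minStable⇒related-between (trans (sym x∼p) x∼c) p≤b b≤c)

mainTheorem11 : {a ℓ r : Level} (𝐒 : SkewHilbertAlgebra a ℓ)
    (Θ : SkewHilbertAlgebra.S 𝐒 → SkewHilbertAlgebra.S 𝐒 → Set r) →
    IsCongruence 𝐒 Θ →
    ∀ (x : SkewHilbertAlgebra.S 𝐒) → Convex 𝐒 (Θ x)
mainTheorem11 𝐒 Θ isCongruence =
  minStable⇒convex-classes 𝐒 (IsAlgebraicCongruence.isEquivalence isAlgebraicCongruence) minStable
  where open IsCongruence isCongruence
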